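{- Let $\mathrm{Op}:\mathcal{U}$ and $\mathrm{Ar}:\mathrm{Op}\to\mathcal{U}$ be such that there is $a_0:\mathrm{Op}$ with $\mathrm{Ar}\,a_0=\mathbb{0}$ and $a_2:\mathrm{Op}$ with $\mathrm{Ar}\,a_2=\mathbb{2}$. Let $\mathrm{Size}$ be the W-type for $(\mathrm{Op},\mathrm{Ar})$ with the plump order $<$, let $0^s:=\sigma\,a_0\,b$ (for the unique $b:\mathbb{0}\to\mathrm{Size}$) and $i\sqcup^s j:=\sigma\,a_2\,b_{i,j}$ where $b_{i,j}\,0=i$ and $b_{i,j}\,1=j$. Then $(\mathrm{Size},<,0^s,\sqcup^s)$ is a type of sizes. Furthermore, for every $a:\mathrm{Op}$ and every family $b:\mathrm{Ar}\,a\to\mathrm{Size}$, the size $\sigma\,a\,b$ is an upper bound of $b$ with respect to $<$, i.e. $\forall(x:\mathrm{Ar}\,a).\,b\,x<\sigma\,a\,b$.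
   Context: We work in extensional type theory as the internal language of a topos with natural numbers object, universes $\mathcal{U}$ and impredicative $\mathrm{Prop}$. $\mathbb{0}$ and $\mathbb{2}$ are the empty type and the two-element type $\{0,1\}$. The W-type $\mathrm{Size}$ for $(\mathrm{Op},\mathrm{Ar})$ is the inductive type with the single constructor $\sigma:(\sum_{a:\mathrm{Op}}(\mathrm{Ar}\,a\to\mathrm{Size}))\to\mathrm{Size}$ (written $\sigma\,a\,b$). The plump order consists of the least relations $<,\le:\mathrm{Size}\to\mathrm{Size}\to\mathrm{Prop}$ such that for all $a:\mathrm{Op}$, $b:\mathrm{Ar}\,a\to\mathrm{Size}$, $i:\mathrm{Size}$: if $\forall(x:\mathrm{Ar}\,a).\,b\,x<i$ then $\sigma\,a\,b\le i$; and if $\exists(x:\mathrm{Ar}\,a).\,i\le b\,x$ then $i<\sigma\,a\,b$. A type of sizes is $\mathrm{Size}:\mathcal{U}$ with a relation $<$ valued in $\mathrm{Prop}$ that is transitive and well-founded (for all $\varphi:\mathrm{Size}\to\mathrm{Prop}$, $(\forall i.(\forall j.\,j<i\to\varphi\,j)\to\varphi\,i)\to\forall i.\,\varphi\,i$), a distinguished element $0^s$, and a binary operation $\sqcup^s$ with $i<i\sqcup^s j$ and $j<i\sqcup^s j$ for all $i,j$. -}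

module Defs where

open import Level using (Level; _⊔_; suc; Lift; lift)
open import Data.Empty using (⊥)
open import Data.Bool using (Bool; true; false)
open import Data.Product using (Σ; ∃; _,_)
open import Function using (id)
open import Relation.Binary.PropositionalEquality using (_≡_; subst)

record IsTypeOfSizes {ℓ r : Level} (p : Level) (Size : Set ℓ)
    (_<_ : Size → Size → Set r) (0ˢ : Size) (_⊔ˢ_ : Size → Size → Size)
    : Set (ℓ ⊔ r ⊔ suc p) where
  field
    trans  : ∀ {i j k} → i < j → j < k → i < k
    wf     : (φ : Size → Set p) →
             (∀ i → (∀ j → j < i → φ j) → φ i) → ∀ i → φ i
    <-⊔ˡ   : ∀ i j → i < (i ⊔ˢ j)
    <-⊔ʳ   : ∀ i j → j < (i ⊔ˢ j)

module WType {ℓ : Level} (Op : Set ℓ) (Ar : Op → Set ℓ) where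

  data Size : Set ℓ where
    σ : (a : Op) → (Ar a → Size) → Size

  mutual
    data _≤_ : Size → Size → Set ℓ where
      ≤-intro : ∀ {a b i} → (∀ x → b x < i) → σ a b ≤ i

    data _<_ : Size → Size → Set ℓ where
      <-intro : ∀ {a b i} → (x : Ar a) → i ≤ b x → i < σ a b

  zeroˢ : (a₀ : Op) → Ar a₀ ≡ Lift ℓ ⊥ → Size
  zeroˢ a₀ e = σ a₀ (λ x → elim (subst id e x))
    where elim : Lift ℓ ⊥ → Size
          elim (lift ())

  -- i ⊔ˢ j := σ a₂ b_{i,j} with b_{i,j} 0 = i, b_{i,j} 1 = j (0 = false, 1 = true)
  joinˢ : (a₂ : Op) → Ar a₂ ≡ Lift ℓ Bool → Size → Size → Size
  joinˢ a₂ e i j = σ a₂ (λ x → pick (subst id e x))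
    where pick : Lift ℓ Bool → Size
          pick (lift false) = i
          pick (lift true)  = j

-- The plump order is built so that j < σ a b means j ≤ b x for some branch x,
-- and σ a b ≤ i means every branch lies below i.  Hence σ a b is a strict upper
-- bound of its branches (via reflexivity of ≤), < and ≤ compose transitively by
-- a mutual induction on the derivations, and every j < σ a b is accessible
-- because it lies below a structurally smaller tree b x.  No axiom constrains
-- 0ˢ, and i, j < i ⊔ˢ j is the upper-bound property for the tree i ⊔ˢ j.
module Submission where

open import Defs
open import Level using (Level; Lift; lift)
open import Data.Empty using (⊥)
open import Data.Bool using (Bool; true; false)
open import Data.Product using (_×_; _,_)
open import Function using (id)
open import Induction.WellFounded using (WellFounded; Acc; acc; module All)
open import Relation.Binary.PropositionalEquality using (_≡_; refl; sym; subst)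
open import Relation.Binary.PropositionalEquality.Properties using (subst-subst-sym)

module PlumpOrder {ℓ : Level} (Op : Set ℓ) (Ar : Op → Set ℓ) where
  open WType Op Ar

  ≤-refl : ∀ i → i ≤ i
  ≤-refl (σ a b) = ≤-intro (λ x → <-intro x (≤-refl (b x)))

  <-σ : ∀ {a} (b : Ar a → Size) (x : Ar a) → b x < σ a b
  <-σ b x = <-intro x (≤-refl (b x))

  <-σ-≡ : ∀ {a} {b : Ar a → Size} {i} (x : Ar a) → b x ≡ i → i < σ a b
  <-σ-≡ {b = b} x refl = <-σ b x

  mutual
    <-≤-trans : ∀ {i j k} → i < j → j ≤ k → i < k
    <-≤-trans (<-intro x i≤bx) (≤-intro b<k) = ≤-<-trans i≤bx (b<k x)

    ≤-<-trans : ∀ {i j k} → i ≤ j → j < k → i < k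
    ≤-<-trans i≤j (<-intro x j≤bx) = <-intro x (≤-trans i≤j j≤bx)

    ≤-trans : ∀ {i j k} → i ≤ j → j ≤ k → i ≤ k
    ≤-trans (≤-intro b<j) j≤k = ≤-intro (λ x → <-≤-trans (b<j x) j≤k)

  <⇒≤ : ∀ {i j} → i < j → i ≤ j
  <⇒≤ {σ a b} (<-intro x (≤-intro b<c)) = ≤-intro (λ y → <-intro x (<⇒≤ (b<c y)))

  <-trans : ∀ {i j k} → i < j → j < k → i < k
  <-trans i<j = ≤-<-trans (<⇒≤ i<j)

  <-acc : ∀ i {j} → j < i → Acc _<_ j
  <-acc (σ a b) (<-intro x j≤bx) = acc (λ k<j → <-acc (b x) (<-≤-trans k<j j≤bx))

  <-wellFounded : WellFounded _<_
  <-wellFounded i = acc (<-acc i)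

  root : Size → Op
  root (σ a _) = a

  branch : (s : Size) → Ar (root s) → Size
  branch (σ _ b) = b

  module _ (a : Op) (e : Ar a ≡ Lift ℓ Bool) (i j : Size) where

    -- joinˢ reads its branches through subst id e, so the branch at the
    -- transported label is computed by cancelling the two transports.
    branch-joinˢ-false : branch (joinˢ a e i j) (subst id (sym e) (lift false)) ≡ i
    branch-joinˢ-false with subst id e (subst id (sym e) (lift false)) | subst-subst-sym {P = id} e {lift false}
    ... | .(lift false) | refl = refl

    branch-joinˢ-true : branch (joinˢ a e i j) (subst id (sym e) (lift true)) ≡ j
    branch-joinˢ-true with subst id e (subst id (sym e) (lift true)) | subst-subst-sym {P = id} e {lift true}
    ... | .(lift true) | refl = refl

    <-joinˢˡ : i < joinˢ a e i j
    <-joinˢˡ = <-σ-≡ (subst id (sym e) (lift false)) branch-joinˢ-false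

    <-joinˢʳ : j < joinˢ a e i j
    <-joinˢʳ = <-σ-≡ (subst id (sym e) (lift true)) branch-joinˢ-true

lemma5p5 : {ℓ : Level} (p : Level) (Op : Set ℓ) (Ar : Op → Set ℓ)
    (a₀ : Op) (e₀ : Ar a₀ ≡ Lift ℓ ⊥) (a₂ : Op) (e₂ : Ar a₂ ≡ Lift ℓ Bool) →
    (IsTypeOfSizes p (WType.Size Op Ar) (WType._<_ Op Ar)
    (WType.zeroˢ Op Ar a₀ e₀) (WType.joinˢ Op Ar a₂ e₂))
    × ((a : Op) (b : Ar a → WType.Size Op Ar) (x : Ar a) →
    WType._<_ Op Ar (b x) (WType.σ a b))
lemma5p5 p Op Ar a₀ e₀ a₂ e₂ =
  record
    { trans = <-trans
    ; wf    = λ φ step → All.wfRec <-wellFounded p φ (λ i ih → step i (λ j → ih))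
    ; <-⊔ˡ  = <-joinˢˡ a₂ e₂
    ; <-⊔ʳ  = <-joinˢʳ a₂ e₂
    }
  , λ a → <-σ
  where open PlumpOrder Op Ar
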